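{- Let $n\ge 2$, $1\le m<n$, and let $S_{n-1}$ be the star graph on vertices $v_1,\dots,v_n$ whose center $v_1$ is adjacent to all of $v_2,\dots,v_n$ and which has no other edges. Then the eigenvectors $\mathbf{v}_j$ ($1\le j\le n$) of the $m$-Laplacian $L^{(m)}_{S_{n-1}}$ are \[ \mathbf{v}_j=\begin{cases}(1,1,\dots,1)^T & j=1,\\ (1-n,1,\dots,1)^T & j=2,\\ \epsilon_{j-1}-\epsilon_j & 3\le j\le n,\end{cases} \] where $\epsilon_k$ is the $n\times 1$ vector whose $k$th entry is $1$ and all other entries are $0$, with corresponding eigenvalues \[ \lambda_j=\begin{cases}0 & j=1,\\ n\,a_{1,m} & j=2,\\ a_{1,m}+(n-1)a_{2,m} & 3\le j\le n.\end{cases} \]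
   Context: For a positive integer $m$, $(a_{1,m},\dots,a_{m,m})$ denotes the unique solution of the linear system $\sum_{k=1}^m k^{2j}a_{k,m}=1$ if $j=1$ and $=0$ for $2\le j\le m$ (explicitly $a_{k,m}=(-1)^{k+1}\frac{2\binom{2m}{m-k}}{k^2\binom{2m}{m}}$); we use the convention $a_{2,1}=0$. For a simple graph $G$ on vertices $v_1,\dots,v_n$ and $1\le k<n$, $P_{G,k}$ is the $n\times n$ matrix whose $(i,j)$ entry is the number of paths of length $k$ from $v_i$ to $v_j$ with $v_i\neq v_j$, where a path of length $k$ is a sequence of $k+1$ distinct vertices with consecutive vertices adjacent. For $1\le m<n$, the $m$-Laplacian of $G$ is $L^{(m)}_G=D_W-W$ where $W=\sum_{k=1}^m a_{k,m}P_{G,k}$ and $D_W$ is the diagonal matrix of row sums of $W$. -}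

module Defs where

open import Data.Bool using (Bool; true; false; _∧_; _∨_; not; if_then_else_)
open import Data.Nat as ℕ using (ℕ; zero; suc; _∸_; _≤ᵇ_)
open import Data.Nat.Combinatorics using (_C_)
open import Data.Integer as ℤ using (ℤ; +_)
open import Data.Rational using (ℚ; 0ℚ; 1ℚ; _+_; _*_; _-_; -_; _/_)
open import Data.Fin using (Fin; toℕ)
open import Data.Fin.Properties using (_≟_)
open import Data.List using (List; []; _∷_; [_]; map; concatMap; filter; length; allFin)
open import Data.Bool.ListAction using (any)
open import Relation.Nullary.Decidable using (⌊_⌋)
open import Relation.Binary.PropositionalEquality using (_≡_; refl)

∑ : ∀ {n} → (Fin n → ℚ) → ℚ
∑ {zero}  f = 0ℚ
∑ {suc n} f = f Data.Fin.zero + ∑ (λ i → f (Data.Fin.suc i))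

ℕ→ℚ : ℕ → ℚ
ℕ→ℚ k = (+ k) / 1

-- p / d, with the convention that division by 0 gives 0 (never used with d = 0 below)
div : ℤ → ℕ → ℚ
div p zero    = 0ℚ
div p (suc d) = p / suc d

-- a_{k,m} = (-1)^{k+1} 2 C(2m, m-k) / (k^2 C(2m,m)) for 1 ≤ k ≤ m, and 0 otherwise
-- (in particular a_{2,1} = 0).
a : ℕ → ℕ → ℚ
a k m = if (1 ≤ᵇ k) ∧ (k ≤ᵇ m) then sgn k * div (+ (2 ℕ.* ((2 ℕ.* m) C (m ∸ k)))) (k ℕ.* k ℕ.* ((2 ℕ.* m) C m)) else 0ℚ
  where
  sgn : ℕ → ℚ
  sgn zero = - 1ℚ
  sgn (suc k) = - sgn k

record SimpleGraph (n : ℕ) : Set where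
  field
    adj   : Fin n → Fin n → Bool
    sym   : ∀ i j → adj i j ≡ adj j i
    irrefl : ∀ i → adj i i ≡ false

open SimpleGraph public

_==_ : ∀ {n} → Fin n → Fin n → Bool
i == j = ⌊ i ≟ j ⌋

-- all walks of length k starting at i, as lists of k+1 vertices
walks : ∀ {n} → SimpleGraph n → ℕ → Fin n → List (List (Fin n))
walks G zero    i = [ i ∷ [] ]
walks G (suc k) i = concatMap (λ j → map (i ∷_) (walks G k j)) (filter (λ j → adj G i j ≟B true) (allFin _))
  where
  open import Data.Bool.Properties using () renaming (_≟_ to _≟B_)

distinct : ∀ {n} → List (Fin n) → Bool
distinct []       = true
distinct (x ∷ xs) = not (any (x ==_) xs) ∧ distinct xs

endsAt : ∀ {n} → Fin n → List (Fin n) → Bool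
endsAt j []           = false
endsAt j (x ∷ [])     = x == j
endsAt j (x ∷ y ∷ xs) = endsAt j (y ∷ xs)

P : ∀ {n} → SimpleGraph n → ℕ → Fin n → Fin n → ℕ
P G k i j = if i == j then 0
            else length (filter (λ w → T? (distinct w ∧ endsAt j w)) (walks G k i))
  where
  open import Relation.Nullary.Decidable using () renaming (T? to T?)

Matrix : ℕ → Set
Matrix n = Fin n → Fin n → ℚ

Wm : ∀ {n} → SimpleGraph n → ℕ → Matrix n
Wm G m i j = sumTo m
  where
  sumTo : ℕ → ℚ
  sumTo zero    = 0ℚ
  sumTo (suc k) = sumTo k + a (suc k) m * ℕ→ℚ (P G (suc k) i j)

mLaplacian : ∀ {n} → SimpleGraph n → ℕ → Matrix n
mLaplacian G m i j = (if i == j then ∑ (λ l → Wm G m i l) else 0ℚ) - Wm G m i j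

_·_ : ∀ {n} → Matrix n → (Fin n → ℚ) → (Fin n → ℚ)
(M · v) i = ∑ (λ j → M i j * v j)

-- The star graph S_{n-1}: vertex 0 (= v_1) adjacent to all others, no other edges
star : (n : ℕ) → SimpleGraph n
star n = record { adj = ad ; sym = sy ; irrefl = ir }
  where
  ad : Fin n → Fin n → Bool
  ad i j = (isZ i ∧ not (isZ j)) ∨ (isZ j ∧ not (isZ i))
    where
    isZ : Fin n → Bool
    isZ Data.Fin.zero = true
    isZ (Data.Fin.suc _) = false
  sy : ∀ i j → ad i j ≡ ad j i
  sy Data.Fin.zero Data.Fin.zero = refl
  sy Data.Fin.zero (Data.Fin.suc j) = refl
  sy (Data.Fin.suc i) Data.Fin.zero = refl
  sy (Data.Fin.suc i) (Data.Fin.suc j) = refl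
  ir : ∀ i → ad i i ≡ false
  ir Data.Fin.zero = refl
  ir (Data.Fin.suc i) = refl

-- Standard basis vector ε_k (1-based index k): entry at vertex v_k is 1
ε : ∀ {n} → ℕ → Fin n → ℚ
ε k i = if suc (toℕ i) ℕ.≡ᵇ k then 1ℚ else 0ℚ

-- Eigenvectors v_j, j = 1..n (1-based)
evec : (n : ℕ) → ℕ → Fin n → ℚ
evec n 1 i = 1ℚ
evec n 2 i = if toℕ i ℕ.≡ᵇ 0 then ℕ→ℚ 1 - ℕ→ℚ n else 1ℚ
evec n j i = ε (j ∸ 1) i - ε j i

-- Eigenvalues λ_j, j = 1..n (1-based)
eval : (n m : ℕ) → ℕ → ℚ
eval n m 1 = 0ℚ
eval n m 2 = ℕ→ℚ n * a 1 m
eval n m j = a 1 m + ℕ→ℚ (n ∸ 1) * a 2 m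

-- In the star every path has length at most 2: a path of length 1 joins the centre to a
-- leaf, one of length 2 joins two distinct leaves through the centre, and every longer walk
-- revisits the centre. So W = Σ_k a_{k,m} P_k is a_{1,m} between the centre and a leaf,
-- a_{2,m} between distinct leaves, and 0 otherwise. Written as (L v)_i = Σ_l W_il (v_i − v_l),
-- the Laplacian kills constant vectors, and on the hub vector and on ε_{j−1} − ε_j (whose
-- leaf coordinates sum to 0) each coordinate reduces to an identity in a_{1,m}, a_{2,m}, n.
module Submission where

open import Defs hiding (sym)
open import Data.Bool using (Bool; true; false; T; _∧_; if_then_else_)
open import Data.Bool.Properties using (if-eta; ∧-zeroʳ) renaming (_≟_ to _≟ᵇ_)
open import Data.Fin using (Fin; zero; suc; toℕ; fromℕ<)
open import Data.Fin.Properties using (toℕ-fromℕ<) renaming (_≟_ to _≟ᶠ_)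
open import Data.List using (List; []; _∷_; [_]; map; concatMap; filter; length; allFin; tabulate)
open import Data.List.Properties using (filter-all; filter-none; concatMap-map; concatMap-pure; map-tabulate; ++-identityʳ)
import Data.List.Relation.Unary.All as All
open All using (All; []; _∷_)
open import Data.List.Relation.Unary.All.Properties using (concat⁺; map⁺; tabulate⁺)
open import Data.Nat as ℕ using (ℕ; zero; suc; _≤_; _<_; s≤s; z≤n)
open import Data.Nat.Properties using (<⇒≤; m≤n⇒m≤1+n)
open import Data.Nat.Coprimality using (1-coprimeTo) renaming (sym to coprime-sym)
open import Data.Empty using (⊥-elim)
open import Data.Product using (_×_; ∃; ∃-syntax; _,_)
import Data.Integer as ℤ
open import Data.Integer.Properties using () renaming (*-identityʳ to ℤ*-identityʳ)
open import Data.Rational using (ℚ; 0ℚ; 1ℚ; mkℚ; _+_; _*_; _-_)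
open import Data.Rational.Solver using (module +-*-Solver)
open import Data.Rational.Properties
  using (normalize-coprime; 1≢0; +-identityˡ; +-identityʳ; +-inverseʳ; *-zeroˡ; *-zeroʳ; *-distribˡ-+; *-distribʳ-+)
open import Function using (_∘_)
open import Relation.Nullary using (¬_; yes; no)
open import Relation.Nullary.Decidable using (T?)
open import Relation.Binary.PropositionalEquality using (_≡_; _≢_; refl; sym; trans; cong; cong₂; subst; module ≡-Reasoning)

open ≡-Reasoning
open +-*-Solver

ℕ→ℚ-suc : ∀ k → ℕ→ℚ (suc k) ≡ 1ℚ + ℕ→ℚ k
ℕ→ℚ-suc k = sym (begin
  1ℚ + ℕ→ℚ k                                      ≡⟨ cong (1ℚ +_) (normalize-coprime (coprime-sym (1-coprimeTo k))) ⟩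
  1ℚ + mkℚ (ℤ.+ k) 0 (coprime-sym (1-coprimeTo k)) ≡⟨ cong (λ z → (ℤ.+ 1 ℤ.+ z) Data.Rational./ 1) (ℤ*-identityʳ (ℤ.+ k)) ⟩
  ℕ→ℚ (suc k)                                     ∎)

∑-cong : ∀ {k} {f g : Fin k → ℚ} → (∀ i → f i ≡ g i) → ∑ f ≡ ∑ g
∑-cong {zero}  f≗g = refl
∑-cong {suc k} f≗g = cong₂ _+_ (f≗g zero) (∑-cong (f≗g ∘ suc))

∑-zero : ∀ {k} → ∑ {k} (λ _ → 0ℚ) ≡ 0ℚ
∑-zero {zero}  = refl
∑-zero {suc k} = cong (0ℚ +_) (∑-zero {k})

∑-const : ∀ {k} c → ∑ {k} (λ _ → c) ≡ ℕ→ℚ k * c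
∑-const {zero}  c = sym (*-zeroˡ c)
∑-const {suc k} c = begin
  c + ∑ {k} (λ _ → c)  ≡⟨ cong (c +_) (∑-const {k} c) ⟩
  c + ℕ→ℚ k * c        ≡⟨ step c (ℕ→ℚ k) ⟩
  (1ℚ + ℕ→ℚ k) * c     ≡⟨ cong (_* c) (ℕ→ℚ-suc k) ⟨
  ℕ→ℚ (suc k) * c      ∎
  where
  step : ∀ c x → c + x * c ≡ (1ℚ + x) * c
  step = solve 2 (λ c x → c :+ x :* c := (con 1ℚ :+ x) :* c) refl

∑-minus : ∀ {k} (f g : Fin k → ℚ) → ∑ (λ i → f i - g i) ≡ ∑ f - ∑ g
∑-minus {zero}  f g = refl
∑-minus {suc k} f g = trans (cong (f zero - g zero +_) (∑-minus (f ∘ suc) (g ∘ suc)))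
                            (interchange (f zero) (g zero) (∑ (f ∘ suc)) (∑ (g ∘ suc)))
  where
  interchange : ∀ a b c d → a - b + (c - d) ≡ (a + c) - (b + d)
  interchange = solve 4 (λ a b c d → a :- b :+ (c :- d) := (a :+ c) :- (b :+ d)) refl

∑-const-minus : ∀ {k} c (f : Fin k → ℚ) → ∑ (λ i → c - f i) ≡ ℕ→ℚ k * c - ∑ f
∑-const-minus {k} c f = trans (∑-minus (λ _ → c) f) (cong (_- ∑ f) (∑-const {k} c))

∑-*ˡ : ∀ {k} c (f : Fin k → ℚ) → ∑ (λ i → c * f i) ≡ c * ∑ f
∑-*ˡ {zero}  c f = sym (*-zeroʳ c)
∑-*ˡ {suc k} c f = trans (cong (c * f zero +_) (∑-*ˡ c (f ∘ suc))) (sym (*-distribˡ-+ c (f zero) (∑ (f ∘ suc))))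

∑-*ʳ : ∀ {k} c (f : Fin k → ℚ) → ∑ (λ i → f i * c) ≡ ∑ f * c
∑-*ʳ {zero}  c f = sym (*-zeroˡ c)
∑-*ʳ {suc k} c f = trans (cong (f zero * c +_) (∑-*ʳ c (f ∘ suc))) (sym (*-distribʳ-+ c (f zero) (∑ (f ∘ suc))))

suc-== : ∀ {k} (i j : Fin k) → (suc i == suc j) ≡ (i == j)
suc-== i j with i ≟ᶠ j
... | yes _ = refl
... | no _  = refl

∑-delta : ∀ {k} (i : Fin k) c (v : Fin k → ℚ) → ∑ (λ l → (if i == l then c else 0ℚ) * v l) ≡ c * v i
∑-delta {suc k} zero    c v = begin
  c * v zero + ∑ (λ l → 0ℚ * v (suc l))  ≡⟨ cong (c * v zero +_) (trans (∑-cong (*-zeroˡ ∘ v ∘ suc)) (∑-zero {k})) ⟩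
  c * v zero + 0ℚ                        ≡⟨ +-identityʳ _ ⟩
  c * v zero                             ∎
∑-delta {suc k} (suc i) c v = begin
  0ℚ * v zero + ∑ (λ l → (if suc i == suc l then c else 0ℚ) * v (suc l))  ≡⟨ cong₂ _+_ (*-zeroˡ (v zero)) (∑-cong shift) ⟩
  0ℚ + ∑ (λ l → (if i == l then c else 0ℚ) * v (suc l))                  ≡⟨ cong (0ℚ +_) (∑-delta i c (v ∘ suc)) ⟩
  0ℚ + c * v (suc i)                                                     ≡⟨ +-identityˡ _ ⟩
  c * v (suc i)                                                          ∎
  where
  shift : ∀ l → (if suc i == suc l then c else 0ℚ) * v (suc l) ≡ (if i == l then c else 0ℚ) * v (suc l)
  shift l = cong (λ b → (if b then c else 0ℚ) * v (suc l)) (suc-== i l)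

∑-ε : ∀ {k} t → t < k → ∑ {k} (ε (suc t)) ≡ 1ℚ
∑-ε {suc k} zero    _         = cong (1ℚ +_) (∑-zero {k})
∑-ε {suc k} (suc t) (s≤s t<k) = trans (+-identityˡ _) (∑-ε t t<k)

ε-diagonal : ∀ {k} (i : Fin k) → ε (suc (toℕ i)) i ≡ 1ℚ
ε-diagonal zero    = refl
ε-diagonal (suc i) = ε-diagonal i

ε-off-diagonal : ∀ {k} (i : Fin k) → ε (suc (suc (toℕ i))) i ≡ 0ℚ
ε-off-diagonal zero    = refl
ε-off-diagonal (suc i) = ε-off-diagonal i

ε-difference-at : ∀ {k} (i : Fin k) t → toℕ i ≡ t → ε (suc t) i - ε (suc (suc t)) i ≡ 1ℚ
ε-difference-at i _ refl = cong₂ _-_ (ε-diagonal i) (ε-off-diagonal i)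

laplacian : ∀ {n} → Matrix n → Matrix n
laplacian W i j = (if i == j then ∑ (W i) else 0ℚ) - W i j

laplacian-· : ∀ {n} (W : Matrix n) v (i : Fin n) → (laplacian W · v) i ≡ ∑ (λ l → W i l * (v i - v l))
laplacian-· W v i = begin
  ∑ (λ l → (D l - W i l) * v l)    ≡⟨ ∑-cong (λ l → expand (D l) (W i l) (v l)) ⟩
  ∑ (λ l → D l * v l - Wv l)       ≡⟨ ∑-minus (λ l → D l * v l) Wv ⟩
  ∑ (λ l → D l * v l) - ∑ Wv       ≡⟨ cong (_- ∑ Wv) (∑-delta i (∑ (W i)) v) ⟩
  ∑ (W i) * v i - ∑ Wv             ≡⟨ cong (_- ∑ Wv) (∑-*ʳ (v i) (W i)) ⟨
  ∑ (λ l → W i l * v i) - ∑ Wv     ≡⟨ ∑-minus (λ l → W i l * v i) Wv ⟨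
  ∑ (λ l → W i l * v i - Wv l)     ≡⟨ ∑-cong (λ l → factor (W i l) (v i) (v l)) ⟩
  ∑ (λ l → W i l * (v i - v l))    ∎
  where
  D Wv : _ → ℚ
  D l = if i == l then ∑ (W i) else 0ℚ
  Wv l = W i l * v l
  expand : ∀ d w u → (d - w) * u ≡ d * u - w * u
  expand = solve 3 (λ d w u → (d :- w) :* u := d :* u :- w :* u) refl
  factor : ∀ w a b → w * a - w * b ≡ w * (a - b)
  factor = solve 3 (λ w a b → w :* a :- w :* b := w :* (a :- b)) refl

laplacian-const : ∀ {n} (W : Matrix n) c (i : Fin n) → (laplacian W · (λ _ → c)) i ≡ 0ℚ
laplacian-const {n} W c i = begin
  (laplacian W · (λ _ → c)) i  ≡⟨ laplacian-· W _ i ⟩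
  ∑ (λ l → W i l * (c - c))    ≡⟨ ∑-cong (λ l → trans (cong (W i l *_) (+-inverseʳ c)) (*-zeroʳ (W i l))) ⟩
  ∑ {n} (λ _ → 0ℚ)             ≡⟨ ∑-zero {n} ⟩
  0ℚ                           ∎

-- Wm sums through a helper local to its definition, which cannot be named here. Abstracting
-- suc k and _+_ in Wm-suc leaves the pattern unification problem helper G m i j k =?
-- partialWeight G m i j k, which names it; afterwards its recursion equations hold by refl.
mutual
  partialWeight : ∀ {n} → SimpleGraph n → ℕ → Fin n → Fin n → ℕ → ℚ
  partialWeight = _

  private
    Wm-suc : ∀ {n} (G : SimpleGraph n) i j k →
      Wm G (suc k) i j ≡ partialWeight G (suc k) i j k + a (suc k) (suc k) * ℕ→ℚ (P G (suc k) i j)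
    Wm-suc G i j k with suc k | _+_
    ... | m | plus = refl

Wm-short-paths : ∀ {n} (G : SimpleGraph n) m i j → (∀ k → P G (3 ℕ.+ k) i j ≡ 0) →
  Wm G m i j ≡ a 1 m * ℕ→ℚ (P G 1 i j) + a 2 m * ℕ→ℚ (P G 2 i j)
Wm-short-paths G zero i j _ = sym (cong₂ _+_ (*-zeroˡ (ℕ→ℚ (P G 1 i j))) (*-zeroˡ (ℕ→ℚ (P G 2 i j))))
Wm-short-paths G (suc zero) i j _ = begin
  0ℚ + a 1 1 * ℕ→ℚ (P G 1 i j)                      ≡⟨ +-identityˡ _ ⟩
  a 1 1 * ℕ→ℚ (P G 1 i j)                           ≡⟨ +-identityʳ _ ⟨
  a 1 1 * ℕ→ℚ (P G 1 i j) + 0ℚ                      ≡⟨ cong (a 1 1 * ℕ→ℚ (P G 1 i j) +_) (*-zeroˡ (ℕ→ℚ (P G 2 i j))) ⟨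
  a 1 1 * ℕ→ℚ (P G 1 i j) + 0ℚ * ℕ→ℚ (P G 2 i j)    ∎
Wm-short-paths G m@(suc (suc m′)) i j no-long-paths =
  trans (stable m′) (cong (_+ a 2 m * ℕ→ℚ (P G 2 i j)) (+-identityˡ (a 1 m * ℕ→ℚ (P G 1 i j))))
  where
  stable : ∀ k → partialWeight G m i j (2 ℕ.+ k) ≡ partialWeight G m i j 2
  stable zero    = refl
  stable (suc k) = begin
    w + a (3 ℕ.+ k) m * ℕ→ℚ (P G (3 ℕ.+ k) i j)  ≡⟨ cong (λ p → w + a (3 ℕ.+ k) m * ℕ→ℚ p) (no-long-paths k) ⟩
    w + a (3 ℕ.+ k) m * 0ℚ                       ≡⟨ cong (w +_) (*-zeroʳ (a (3 ℕ.+ k) m)) ⟩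
    w + 0ℚ                                       ≡⟨ +-identityʳ w ⟩
    w                                            ≡⟨ stable k ⟩
    partialWeight G m i j 2                      ∎
    where
    w = partialWeight G m i j (2 ℕ.+ k)

pathsTo : ∀ {n} → Fin n → List (List (Fin n)) → ℕ
pathsTo j ws = length (filter (λ w → T? (distinct w ∧ endsAt j w)) ws)

P≡0 : ∀ {n} (G : SimpleGraph n) k i j → All (λ w → ¬ T (distinct w ∧ endsAt j w)) (walks G k i) → P G k i j ≡ 0
P≡0 G k i j no-path =
  trans (cong (λ c → if i == j then 0 else c) (cong length (filter-none (λ w → T? (distinct w ∧ endsAt j w)) no-path)))
        (if-eta (i == j))

revisit-is-no-path : ∀ {n} (j : Fin n) {w} → distinct w ≡ false → ¬ T (distinct w ∧ endsAt j w)
revisit-is-no-path j e rewrite e = λ ()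

distinct-∷-false : ∀ {n} (x : Fin n) {w} → distinct w ≡ false → distinct (x ∷ w) ≡ false
distinct-∷-false x e rewrite e = ∧-zeroʳ _

walks-start : ∀ {n} (G : SimpleGraph n) k i → All (λ w → ∃[ w′ ] w ≡ i ∷ w′) (walks G k i)
walks-start G zero    i = (_ , refl) ∷ []
walks-start {n} G (suc k) i =
  concat⁺ (map⁺ (All.universal (λ j → map⁺ (All.universal (λ w → w , refl) (walks G k j)))
    (filter (λ j → adj G i j ≟ᵇ true) (allFin n))))

concatMap-singleton : ∀ {A B : Set} (f : A → B) xs → concatMap (λ x → [ f x ]) xs ≡ map f xs
concatMap-singleton f xs = trans (sym (concatMap-map [_] f xs)) (concatMap-pure (map f xs))

length-filter-tabulate-unique : ∀ {A : Set} {k} (β : A → Bool) (f : Fin k → A) (r : Fin k) →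
  (∀ q → β (f q) ≡ (q == r)) → length (filter (λ x → T? (β x)) (tabulate f)) ≡ 1
length-filter-tabulate-unique β f zero hit rewrite hit zero =
  cong suc (cong length (filter-none (λ x → T? (β x)) (tabulate⁺ (λ q → subst T (hit (suc q))))))
length-filter-tabulate-unique β f (suc r) hit rewrite hit zero =
  length-filter-tabulate-unique β (f ∘ suc) r (λ q → trans (hit (suc q)) (suc-== q r))

starWeights : ∀ {n} → ℚ → ℚ → Matrix (suc n)
starWeights x y zero    zero    = 0ℚ
starWeights x y zero    (suc _) = x
starWeights x y (suc _) zero    = x
starWeights x y (suc p) (suc r) = if p == r then 0ℚ else y

laplacian-starWeights-center : ∀ {n} x y (v : Fin (suc n) → ℚ) →
  (laplacian (starWeights x y) · v) zero ≡ x * ∑ (λ r → v zero - v (suc r))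
laplacian-starWeights-center x y v = begin
  (laplacian (starWeights x y) · v) zero                         ≡⟨ laplacian-· (starWeights x y) v zero ⟩
  0ℚ * (v zero - v zero) + ∑ (λ r → x * (v zero - v (suc r)))     ≡⟨ cong₂ _+_ (*-zeroˡ (v zero - v zero)) (∑-*ˡ x (λ r → v zero - v (suc r))) ⟩
  0ℚ + x * ∑ (λ r → v zero - v (suc r))                          ≡⟨ +-identityˡ _ ⟩
  x * ∑ (λ r → v zero - v (suc r))                               ∎

laplacian-starWeights-leaf : ∀ {n} x y (v : Fin (suc n) → ℚ) p →
  (laplacian (starWeights x y) · v) (suc p) ≡ x * (v (suc p) - v zero) + y * ∑ (λ r → v (suc p) - v (suc r))
laplacian-starWeights-leaf x y v p = trans (laplacian-· (starWeights x y) v (suc p))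
  (cong (x * (v (suc p) - v zero) +_) (trans (∑-cong off-diagonal) (∑-*ˡ y (λ r → v (suc p) - v (suc r)))))
  where
  off-diagonal : ∀ r → (if p == r then 0ℚ else y) * (v (suc p) - v (suc r)) ≡ y * (v (suc p) - v (suc r))
  off-diagonal r with p ≟ᶠ r
  ... | yes refl = trans (*-zeroˡ (v (suc p) - v (suc p))) (sym (trans (cong (y *_) (+-inverseʳ (v (suc p)))) (*-zeroʳ y)))
  ... | no _     = refl

module _ {n : ℕ} where

  private
    S = star (suc n)

  walks-center : ∀ k → walks S (suc k) zero ≡ concatMap (λ q → map (zero ∷_) (walks S k q)) (tabulate suc)
  walks-center k = cong (concatMap (λ q → map (zero ∷_) (walks S k q)))
    (filter-all (λ j → adj S zero j ≟ᵇ true) (tabulate⁺ {f = suc} (λ _ → refl)))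

  walks-leaf : ∀ k p → walks S (suc k) (suc p) ≡ map (suc p ∷_) (walks S k zero)
  walks-leaf k p = trans
    (cong (concatMap (λ q → map (suc p ∷_) (walks S k q)))
          (cong (zero ∷_) (filter-none (λ j → adj S (suc p) j ≟ᵇ true) (tabulate⁺ {f = suc} (λ _ ())))))
    (++-identityʳ _)

  walks-center-1 : walks S 1 zero ≡ tabulate (λ q → zero ∷ suc q ∷ [])
  walks-center-1 = trans (walks-center 0)
    (trans (concatMap-singleton (λ q → zero ∷ q ∷ []) (tabulate suc)) (map-tabulate suc (λ q → zero ∷ q ∷ [])))

  walks-leaf-2 : ∀ p → walks S 2 (suc p) ≡ tabulate (λ q → suc p ∷ zero ∷ suc q ∷ [])
  walks-leaf-2 p = trans (walks-leaf 1 p)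
    (trans (cong (map (suc p ∷_)) walks-center-1) (map-tabulate (λ q → zero ∷ suc q ∷ []) (suc p ∷_)))

  center-walks-revisit : ∀ k → All (λ w → distinct w ≡ false) (walks S (2 ℕ.+ k) zero)
  center-walks-revisit k rewrite walks-center (suc k) = concat⁺ (map⁺ (tabulate⁺ via-leaf))
    where
    via-leaf : ∀ q → All (λ w → distinct w ≡ false) (map (zero ∷_) (walks S (suc k) (suc q)))
    via-leaf q rewrite walks-leaf k q = map⁺ (map⁺ (All.map (λ { (_ , refl) → refl }) (walks-start S k zero)))

  long-walks-revisit : ∀ k i → All (λ w → distinct w ≡ false) (walks S (3 ℕ.+ k) i)
  long-walks-revisit k zero    = center-walks-revisit (suc k)
  long-walks-revisit k (suc p) rewrite walks-leaf (2 ℕ.+ k) p =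
    map⁺ (All.map (λ {w} → distinct-∷-false (suc p) {w}) (center-walks-revisit k))

  P-star-long : ∀ k i j → P S (3 ℕ.+ k) i j ≡ 0
  P-star-long k i j = P≡0 S (3 ℕ.+ k) i j (All.map (λ {w} → revisit-is-no-path j {w}) (long-walks-revisit k i))

  P-star-1 : ∀ i j → P S 1 i j ≡ (if adj S i j then 1 else 0)
  P-star-1 zero    zero    = refl
  P-star-1 zero    (suc r) = begin
    pathsTo (suc r) (walks S 1 zero)                         ≡⟨ cong (pathsTo (suc r)) walks-center-1 ⟩
    pathsTo (suc r) (tabulate (λ q → zero ∷ suc q ∷ []))     ≡⟨ length-filter-tabulate-unique _ _ r (λ q → suc-== q r) ⟩
    1                                                        ∎
  P-star-1 (suc p) zero    = cong (pathsTo zero) (walks-leaf 0 p)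
  P-star-1 (suc p) (suc r) =
    trans (cong (λ c → if suc p == suc r then 0 else c) (cong (pathsTo (suc r)) (walks-leaf 0 p))) (if-eta (suc p == suc r))

  twoStepPaths : Fin (suc n) → Fin (suc n) → ℕ
  twoStepPaths (suc p) (suc r) = if p == r then 0 else 1
  twoStepPaths _       _       = 0

  P-star-2 : ∀ i j → P S 2 i j ≡ twoStepPaths i j
  P-star-2 zero    j       = P≡0 S 2 zero j (All.map (λ {w} → revisit-is-no-path j {w}) (center-walks-revisit 0))
  P-star-2 (suc p) zero    = P≡0 S 2 (suc p) zero (subst (All _) (sym (walks-leaf-2 p)) (tabulate⁺ not-at-center))
    where
    not-at-center : ∀ q → ¬ T (distinct (suc p ∷ zero ∷ suc q ∷ []) ∧ false)
    not-at-center q rewrite ∧-zeroʳ (distinct (suc p ∷ zero ∷ suc q ∷ [])) = λ ()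
  P-star-2 (suc p) (suc r) with p ≟ᶠ r
  ... | yes refl = refl
  ... | no  p≢r  = begin
    pathsTo (suc r) (walks S 2 (suc p))                           ≡⟨ cong (pathsTo (suc r)) (walks-leaf-2 p) ⟩
    pathsTo (suc r) (tabulate (λ q → suc p ∷ zero ∷ suc q ∷ []))  ≡⟨ length-filter-tabulate-unique _ _ r path-iff ⟩
    1                                                             ∎
    where
    path-iff : ∀ q → distinct (suc p ∷ zero ∷ suc q ∷ []) ∧ endsAt (suc r) (suc p ∷ zero ∷ suc q ∷ []) ≡ (q == r)
    path-iff q with q ≟ᶠ r
    ... | no _     = ∧-zeroʳ _
    ... | yes refl with p ≟ᶠ q
    ...   | yes p≡q = ⊥-elim (p≢r p≡q)
    ...   | no _    = refl

  Wm-star : ∀ m i j → Wm S m i j ≡ starWeights (a 1 m) (a 2 m) i j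
  Wm-star m i j = begin
    Wm S m i j                                                    ≡⟨ Wm-short-paths S m i j (λ k → P-star-long k i j) ⟩
    x * ℕ→ℚ (P S 1 i j) + y * ℕ→ℚ (P S 2 i j)                     ≡⟨ cong₂ (λ s t → x * ℕ→ℚ s + y * ℕ→ℚ t) (P-star-1 i j) (P-star-2 i j) ⟩
    x * ℕ→ℚ (if adj S i j then 1 else 0) + y * ℕ→ℚ (twoStepPaths i j) ≡⟨ weights i j ⟩
    starWeights x y i j                                           ∎
    where
    x = a 1 m
    y = a 2 m
    x₀y₀ : ∀ x y → x * 0ℚ + y * 0ℚ ≡ 0ℚ
    x₀y₀ = solve 2 (λ x y → x :* con 0ℚ :+ y :* con 0ℚ := con 0ℚ) refl
    x₁y₀ : ∀ x y → x * 1ℚ + y * 0ℚ ≡ x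
    x₁y₀ = solve 2 (λ x y → x :* con 1ℚ :+ y :* con 0ℚ := x) refl
    x₀y₁ : ∀ x y → x * 0ℚ + y * 1ℚ ≡ y
    x₀y₁ = solve 2 (λ x y → x :* con 0ℚ :+ y :* con 1ℚ := y) refl
    weights : ∀ i j → x * ℕ→ℚ (if adj S i j then 1 else 0) + y * ℕ→ℚ (twoStepPaths i j) ≡ starWeights x y i j
    weights zero    zero    = x₀y₀ x y
    weights zero    (suc r) = x₁y₀ x y
    weights (suc p) zero    = x₁y₀ x y
    weights (suc p) (suc r) with p == r
    ... | true  = x₀y₀ x y
    ... | false = x₀y₁ x y

  mLaplacian-star : ∀ m v i → (mLaplacian S m · v) i ≡ (laplacian (starWeights (a 1 m) (a 2 m)) · v) i
  mLaplacian-star m v i = begin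
    (mLaplacian S m · v) i                                       ≡⟨ laplacian-· (Wm S m) v i ⟩
    ∑ (λ l → Wm S m i l * (v i - v l))                           ≡⟨ ∑-cong (λ l → cong (_* (v i - v l)) (Wm-star m i l)) ⟩
    ∑ (λ l → starWeights (a 1 m) (a 2 m) i l * (v i - v l))      ≡⟨ laplacian-· (starWeights (a 1 m) (a 2 m)) v i ⟨
    (laplacian (starWeights (a 1 m) (a 2 m)) · v) i              ∎

  mLaplacian-star-center : ∀ m v → (mLaplacian S m · v) zero ≡ a 1 m * ∑ (λ r → v zero - v (suc r))
  mLaplacian-star-center m v = trans (mLaplacian-star m v zero) (laplacian-starWeights-center (a 1 m) (a 2 m) v)

  mLaplacian-star-leaf : ∀ m v p →
    (mLaplacian S m · v) (suc p) ≡ a 1 m * (v (suc p) - v zero) + a 2 m * ∑ (λ r → v (suc p) - v (suc r))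
  mLaplacian-star-leaf m v p = trans (mLaplacian-star m v (suc p)) (laplacian-starWeights-leaf (a 1 m) (a 2 m) v p)

  hub-eigenvector : ∀ m i → (mLaplacian S m · evec (suc n) 2) i ≡ eval (suc n) m 2 * evec (suc n) 2 i
  hub-eigenvector m zero = begin
    (mLaplacian S m · evec (suc n) 2) zero   ≡⟨ mLaplacian-star-center m (evec (suc n) 2) ⟩
    x * ∑ {n} (λ _ → (1ℚ - N) - 1ℚ)          ≡⟨ cong (x *_) (∑-const {n} ((1ℚ - N) - 1ℚ)) ⟩
    x * (c * ((1ℚ - N) - 1ℚ))                ≡⟨ cong (λ N → x * (c * ((1ℚ - N) - 1ℚ))) (ℕ→ℚ-suc n) ⟩
    x * (c * ((1ℚ - (1ℚ + c)) - 1ℚ))         ≡⟨ identity x c ⟩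
    ((1ℚ + c) * x) * (1ℚ - (1ℚ + c))         ≡⟨ cong (λ N → (N * x) * (1ℚ - N)) (ℕ→ℚ-suc n) ⟨
    (N * x) * (1ℚ - N)                       ∎
    where
    x = a 1 m
    c = ℕ→ℚ n
    N = ℕ→ℚ (suc n)
    identity : ∀ x c → x * (c * ((1ℚ - (1ℚ + c)) - 1ℚ)) ≡ ((1ℚ + c) * x) * (1ℚ - (1ℚ + c))
    identity = solve 2 (λ x c → x :* (c :* ((con 1ℚ :- (con 1ℚ :+ c)) :- con 1ℚ)) := ((con 1ℚ :+ c) :* x) :* (con 1ℚ :- (con 1ℚ :+ c))) refl
  hub-eigenvector m (suc p) = begin
    (mLaplacian S m · evec (suc n) 2) (suc p)        ≡⟨ mLaplacian-star-leaf m (evec (suc n) 2) p ⟩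
    x * (1ℚ - (1ℚ - N)) + y * ∑ {n} (λ _ → 0ℚ)       ≡⟨ cong (λ s → x * (1ℚ - (1ℚ - N)) + y * s) (∑-zero {n}) ⟩
    x * (1ℚ - (1ℚ - N)) + y * 0ℚ                     ≡⟨ identity x y N ⟩
    (N * x) * 1ℚ                                     ∎
    where
    x = a 1 m
    y = a 2 m
    N = ℕ→ℚ (suc n)
    identity : ∀ x y N → x * (1ℚ - (1ℚ - N)) + y * 0ℚ ≡ (N * x) * 1ℚ
    identity = solve 3 (λ x y N → x :* (con 1ℚ :- (con 1ℚ :- N)) :+ y :* con 0ℚ := (N :* x) :* con 1ℚ) refl

  ∑-leaf-difference : ∀ j → 2 ℕ.+ j ≤ n → ∑ (λ r → evec (suc n) (3 ℕ.+ j) (suc r)) ≡ 0ℚ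
  ∑-leaf-difference j 2+j≤n = trans (∑-minus {n} (ε (suc j)) (ε (suc (suc j))))
                                    (cong₂ _-_ (∑-ε j (<⇒≤ 2+j≤n)) (∑-ε (suc j) 2+j≤n))

  leaf-difference-eigenvector : ∀ m j → 2 ℕ.+ j ≤ n → ∀ i →
    (mLaplacian S m · evec (suc n) (3 ℕ.+ j)) i ≡ eval (suc n) m (3 ℕ.+ j) * evec (suc n) (3 ℕ.+ j) i
  leaf-difference-eigenvector m j 2+j≤n zero = begin
    (mLaplacian S m · v) zero           ≡⟨ mLaplacian-star-center m v ⟩
    x * ∑ (λ r → 0ℚ - u r)              ≡⟨ cong (x *_) (∑-const-minus 0ℚ u) ⟩
    x * (c * 0ℚ - ∑ u)                  ≡⟨ cong (λ s → x * (c * 0ℚ - s)) (∑-leaf-difference j 2+j≤n) ⟩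
    x * (c * 0ℚ - 0ℚ)                   ≡⟨ identity x c (eval (suc n) m (3 ℕ.+ j)) ⟩
    eval (suc n) m (3 ℕ.+ j) * 0ℚ       ∎
    where
    v = evec (suc n) (3 ℕ.+ j)
    u = v ∘ suc
    x = a 1 m
    c = ℕ→ℚ n
    identity : ∀ x c e → x * (c * 0ℚ - 0ℚ) ≡ e * 0ℚ
    identity = solve 3 (λ x c e → x :* (c :* con 0ℚ :- con 0ℚ) := e :* con 0ℚ) refl
  leaf-difference-eigenvector m j 2+j≤n (suc p) = begin
    (mLaplacian S m · v) (suc p)                  ≡⟨ mLaplacian-star-leaf m v p ⟩
    x * (u p - 0ℚ) + y * ∑ (λ r → u p - u r)      ≡⟨ cong (λ s → x * (u p - 0ℚ) + y * s) (∑-const-minus (u p) u) ⟩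
    x * (u p - 0ℚ) + y * (c * u p - ∑ u)          ≡⟨ cong (λ s → x * (u p - 0ℚ) + y * (c * u p - s)) (∑-leaf-difference j 2+j≤n) ⟩
    x * (u p - 0ℚ) + y * (c * u p - 0ℚ)           ≡⟨ identity x y c (u p) ⟩
    (x + c * y) * u p                             ∎
    where
    v = evec (suc n) (3 ℕ.+ j)
    u = v ∘ suc
    x = a 1 m
    y = a 2 m
    c = ℕ→ℚ n
    identity : ∀ x y c u → x * (u - 0ℚ) + y * (c * u - 0ℚ) ≡ (x + c * y) * u
    identity = solve 4 (λ x y c u → x :* (u :- con 0ℚ) :+ y :* (c :* u :- con 0ℚ) := (x :+ c :* y) :* u) refl

proposition4p4 : (n m : ℕ) → 2 ≤ n → 1 ≤ m → m < n →
    (j : ℕ) → 1 ≤ j → j ≤ n →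
      (∃ λ (i : Fin n) → evec n j i ≢ 0ℚ) ×
      (∀ (i : Fin n) → (mLaplacian (star n) m · evec n j) i ≡ eval n m j * evec n j i)
proposition4p4 (suc (suc n)) m (s≤s (s≤s z≤n)) _ _ 1 _ _ =
  (zero , 1≢0) , laplacian-const (Wm (star (suc (suc n))) m) 1ℚ
proposition4p4 (suc (suc n)) m (s≤s (s≤s z≤n)) _ _ 2 _ _ =
  (suc zero , 1≢0) , hub-eigenvector m
proposition4p4 (suc (suc n)) m (s≤s (s≤s z≤n)) _ _ (suc (suc (suc j))) _ (s≤s (s≤s 1+j≤n)) =
  (suc leaf , nonzero) , leaf-difference-eigenvector m j (s≤s 1+j≤n)
  where
  j<1+n : j < suc n
  j<1+n = m≤n⇒m≤1+n 1+j≤n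
  leaf = fromℕ< j<1+n
  nonzero : evec (suc (suc n)) (3 ℕ.+ j) (suc leaf) ≢ 0ℚ
  nonzero eq = 1≢0 (trans (sym (ε-difference-at leaf j (toℕ-fromℕ< j<1+n))) eq)
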